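{- Let $G$ be a $K_4$-free graph on $n$ vertices. 1. If $Z$ is a triangle-free induced subgraph of $G$ of maximum order, then $e(G) \le \min\left\{\frac{|Z|\,|G|}{2},\ |Z|\left(|G| - \frac34|Z|\right)\right\}$. 2. If $Z_0$ is a triangle-free induced subgraph of $G$ with $|Z_0| \ge \frac23|G|$, then $e(G) \le |Z_0|\left(|G| - \frac34|Z_0|\right)$.
   Context: $|G|$ is the number of vertices and $e(G)$ the number of edges of $G$. A graph is $K_4$-free if it contains no complete graph on 4 vertices as a subgraph. -}

module Defs where

open import Data.Nat using (ℕ; _+_; _*_; _≤_)
open import Data.Bool using (Bool; true; false; if_then_else_)
open import Data.Fin using (Fin; toℕ)
import Data.Fin as F
open import Data.Fin.Subset using (Subset; _∈_; ∣_∣)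
open import Data.List using (List; map; allFin)
open import Data.Nat.ListAction using (sum)
open import Data.Product using (_×_)
open import Relation.Binary.PropositionalEquality using (_≡_)
open import Relation.Nullary using (¬_)

record Graph (n : ℕ) : Set where
  field
    adj     : Fin n → Fin n → Bool
    symm    : ∀ i j → adj i j ≡ adj j i
    irrefl  : ∀ i → adj i i ≡ false

open Graph public

Adj : ∀ {n} → Graph n → Fin n → Fin n → Set
Adj G i j = adj G i j ≡ true

order : ∀ {n} → Graph n → ℕ
order {n} _ = n

e : ∀ {n} → Graph n → ℕ
e {n} G = sum (map (λ i → sum (map (λ j →
            if (toℕ i Data.Nat.<ᵇ toℕ j) then (if adj G i j then 1 else 0) else 0)
          (allFin n))) (allFin n))

-- G contains K4 as a subgraph: four pairwise adjacent vertices
-- (adjacency forces them distinct, by irreflexivity).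
K4-free : ∀ {n} → Graph n → Set
K4-free {n} G = ∀ (a b c d : Fin n) →
  ¬ (Adj G a b × Adj G a c × Adj G a d × Adj G b c × Adj G b d × Adj G c d)

TriangleFreeIn : ∀ {n} → Graph n → Subset n → Set
TriangleFreeIn {n} G S = ∀ (a b c : Fin n) → a ∈ S → b ∈ S → c ∈ S →
  ¬ (Adj G a b × Adj G a c × Adj G b c)

MaxTriangleFree : ∀ {n} → Graph n → Subset n → Set
MaxTriangleFree {n} G S = TriangleFreeIn G S ×
  (∀ (T : Subset n) → TriangleFreeIn G T → ∣ T ∣ ≤ ∣ S ∣)

{-# OPTIONS --safe #-}
module Submission where

-- Let Y be the complement of Z. In a K₄-free graph every neighbourhood is
-- triangle-free, so all degrees are at most |Z|, whence 2e(G) ≤ |Z||G|.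
-- Counting ordered adjacent pairs, 2e(G) ≤ 2e(Z) + 2 Σ_{y ∈ Y} deg y
-- ≤ 2e(Z) + 2|Y||Z|, and Mantel's bound 4e(Z) ≤ |Z|² finishes part 1.
-- For part 2 apply part 1 to a maximum triangle-free Z, so |Z| ≥ |Z₀|,
-- and use that z ↦ z(|G| − ¾z) is non-increasing for z ≥ ⅔|G|.

open import Defs
open import Data.Nat using (ℕ; zero; suc; _+_; _*_; _≤_; _<ᵇ_; z≤n)
open import Data.Nat.Properties
open import Data.Nat.ListAction using (sum)
open import Data.Nat.Tactic.RingSolver using (solve-∀)
open import Algebra.Properties.Semiring.Sum +-*-semiring
  using (sum-syntax; sum-cong-≗; sum-replicate-zero; ∑-distrib-+; ∑-comm; *-distribˡ-sum; *-distribʳ-sum)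
open import Data.Bool using (Bool; true; false; if_then_else_; _∧_; not)
open import Data.Bool.Properties as Bool using (∧-conicalˡ; ∧-conicalʳ; not-¬)
open import Data.Fin using (Fin; zero; suc; toℕ)
import Data.Fin.Properties as Fin
open import Data.Fin.Subset using (Subset; _∈_; ∣_∣)
open import Data.Fin.Subset.Properties using (anySubset?; _∈?_; ∣p∣≤n)
open import Data.Vec as Vec using ([]; _∷_; lookup)
open import Data.Vec.Properties using (lookup∘tabulate; []=⇒lookup; lookup⇒[]=)
open import Data.List using (map; allFin; tabulate)
import Data.List.Properties as List
open import Data.Product using (_×_; _,_; ∃; proj₂)
open import Data.Sum using (_⊎_; inj₁; inj₂; [_,_]′)
open import Relation.Binary.PropositionalEquality
open import Relation.Nullary using (¬_; Dec; contradiction; yes; no)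
open import Relation.Nullary.Decidable using (_×-dec_; _→-dec_; ¬?)
open import Relation.Nullary.Reflects using (ofʸ; ofⁿ)
open import Relation.Unary using (Pred; Decidable)

χ : Bool → ℕ
χ b = if b then 1 else 0

sum-tabulate : ∀ {n} (f : Fin n → ℕ) → sum (tabulate f) ≡ ∑[ i < n ] f i
sum-tabulate {zero}  f = refl
sum-tabulate {suc n} f = cong (f zero +_) (sum-tabulate (λ i → f (suc i)))

sum-map-allFin : ∀ {n} (f : Fin n → ℕ) → sum (map f (allFin n)) ≡ ∑[ i < n ] f i
sum-map-allFin f = trans (cong sum (List.map-tabulate (λ i → i) f)) (sum-tabulate f)

∑-mono-≤ : ∀ {n} {f g : Fin n → ℕ} → (∀ i → f i ≤ g i) → ∑[ i < n ] f i ≤ ∑[ i < n ] g i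
∑-mono-≤ {zero}  f≤g = z≤n
∑-mono-≤ {suc n} f≤g = +-mono-≤ (f≤g zero) (∑-mono-≤ (λ i → f≤g (suc i)))

χ-split : ∀ b r → χ b ≡ χ (b ∧ r) + χ (b ∧ not r)
χ-split true  true  = refl
χ-split true  false = refl
χ-split false r     = refl

χ-swap : ∀ b c a → χ b * χ (c ∧ a) ≡ χ c * χ (b ∧ a)
χ-swap true  true  a = refl
χ-swap true  false a = refl
χ-swap false true  a = refl
χ-swap false false a = refl

χ*-mono-≤ : ∀ b {x y} → (b ≡ true → x ≤ y) → χ b * x ≤ χ b * y
χ*-mono-≤ true  x≤y = *-monoʳ-≤ 1 (x≤y refl)
χ*-mono-≤ false x≤y = z≤n

module _ {n : ℕ} where

  ⊤ : Fin n → Bool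
  ⊤ _ = true

  infixl 7 _∩_ _∖_

  _∩_ _∖_ : (Fin n → Bool) → (Fin n → Bool) → Fin n → Bool
  (P ∩ R) i = P i ∧ R i
  (P ∖ R) i = P i ∧ not (R i)

  card : (Fin n → Bool) → ℕ
  card P = ∑[ i < n ] χ (P i)

  card-split : ∀ P R → card P ≡ card (P ∩ R) + card (P ∖ R)
  card-split P R = trans (sum-cong-≗ (λ i → χ-split (P i) (R i)))
    (∑-distrib-+ (λ i → χ (P i ∧ R i)) (λ i → χ (P i ∧ not (R i))))

  module _ (G : Graph n) where

    deg : (Fin n → Bool) → Fin n → ℕ
    deg Q i = ∑[ j < n ] χ (Q j ∧ adj G i j)

    -- arcs P P is 2 e(G[P]), each edge being counted in both directions.
    arcs : (Fin n → Bool) → (Fin n → Bool) → ℕ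
    arcs P Q = ∑[ i < n ] (χ (P i) * deg Q i)

    arcs-splitˡ : ∀ P Q R → arcs P Q ≡ arcs (P ∩ R) Q + arcs (P ∖ R) Q
    arcs-splitˡ P Q R = trans (sum-cong-≗ split)
      (∑-distrib-+ (λ i → χ ((P ∩ R) i) * deg Q i) (λ i → χ ((P ∖ R) i) * deg Q i))
      where
      split : ∀ i → χ (P i) * deg Q i ≡ χ ((P ∩ R) i) * deg Q i + χ ((P ∖ R) i) * deg Q i
      split i = trans (cong (_* deg Q i) (χ-split (P i) (R i)))
        (*-distribʳ-+ (deg Q i) (χ ((P ∩ R) i)) (χ ((P ∖ R) i)))

    arcs≡∑∑ : ∀ P Q → arcs P Q ≡ ∑[ i < n ] ∑[ j < n ] (χ (P i) * χ (Q j ∧ adj G i j))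
    arcs≡∑∑ P Q = sum-cong-≗ (λ i → *-distribˡ-sum (χ (P i)) (λ j → χ (Q j ∧ adj G i j)))

    arcs-sym : ∀ P Q → arcs P Q ≡ arcs Q P
    arcs-sym P Q = begin
      arcs P Q                                                ≡⟨ arcs≡∑∑ P Q ⟩
      ∑[ i < n ] ∑[ j < n ] (χ (P i) * χ (Q j ∧ adj G i j))    ≡⟨ ∑-comm (λ i j → χ (P i) * χ (Q j ∧ adj G i j)) ⟩
      ∑[ j < n ] ∑[ i < n ] (χ (P i) * χ (Q j ∧ adj G i j))    ≡⟨ sum-cong-≗ (λ j → sum-cong-≗ (λ i → swap i j)) ⟩
      ∑[ j < n ] ∑[ i < n ] (χ (Q j) * χ (P i ∧ adj G j i))    ≡⟨ arcs≡∑∑ Q P ⟨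
      arcs Q P                                                ∎
      where
      open ≡-Reasoning
      swap : ∀ i j → χ (P i) * χ (Q j ∧ adj G i j) ≡ χ (Q j) * χ (P i ∧ adj G j i)
      swap i j rewrite symm G i j = χ-swap (P i) (Q j) (adj G j i)

    arcs-splitʳ : ∀ P Q R → arcs P Q ≡ arcs P (Q ∩ R) + arcs P (Q ∖ R)
    arcs-splitʳ P Q R = begin
      arcs P Q                         ≡⟨ arcs-sym P Q ⟩
      arcs Q P                         ≡⟨ arcs-splitˡ Q P R ⟩
      arcs (Q ∩ R) P + arcs (Q ∖ R) P  ≡⟨ cong₂ _+_ (arcs-sym (Q ∩ R) P) (arcs-sym (Q ∖ R) P) ⟩
      arcs P (Q ∩ R) + arcs P (Q ∖ R)  ∎
      where open ≡-Reasoning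

    arcs≤inside+2*outside : ∀ P R → arcs P P ≤ arcs (P ∩ R) (P ∩ R) + 2 * arcs (P ∖ R) P
    arcs≤inside+2*outside P R = begin
      arcs P P                                 ≡⟨ arcs-splitˡ P P R ⟩
      arcs (P ∩ R) P + outside                 ≡⟨ cong (_+ outside) (arcs-splitʳ (P ∩ R) P R) ⟩
      inside + arcs (P ∩ R) (P ∖ R) + outside  ≤⟨ +-monoˡ-≤ outside (+-monoʳ-≤ inside across≤outside) ⟩
      inside + outside + outside               ≡⟨ +-assoc inside outside outside ⟩
      inside + (outside + outside)             ≡⟨ cong (λ o → inside + (outside + o)) (+-identityʳ outside) ⟨
      inside + 2 * outside                     ∎
      where
      open ≤-Reasoning
      inside = arcs (P ∩ R) (P ∩ R)
      outside = arcs (P ∖ R) P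
      across≤outside : arcs (P ∩ R) (P ∖ R) ≤ outside
      across≤outside = begin
        arcs (P ∩ R) (P ∖ R)                         ≡⟨ arcs-sym (P ∩ R) (P ∖ R) ⟩
        arcs (P ∖ R) (P ∩ R)                         ≤⟨ m≤m+n _ (arcs (P ∖ R) (P ∖ R)) ⟩
        arcs (P ∖ R) (P ∩ R) + arcs (P ∖ R) (P ∖ R)  ≡⟨ arcs-splitʳ (P ∖ R) P R ⟨
        outside                                      ∎

    arcs≤card*maxdeg : ∀ P Q c → (∀ i → P i ≡ true → deg Q i ≤ c) → arcs P Q ≤ card P * c
    arcs≤card*maxdeg P Q c deg≤c = begin
      arcs P Q                ≤⟨ ∑-mono-≤ (λ i → χ*-mono-≤ (P i) (deg≤c i)) ⟩
      ∑[ i < n ] (χ (P i) * c) ≡⟨ *-distribʳ-sum c (λ i → χ (P i)) ⟨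
      card P * c              ∎
      where open ≤-Reasoning

    arcs≡0 : ∀ P Q → (∀ i j → P i ≡ true → Q j ≡ true → ¬ Adj G i j) → arcs P Q ≡ 0
    arcs≡0 P Q no-edge = begin
      arcs P Q                                               ≡⟨ arcs≡∑∑ P Q ⟩
      ∑[ i < n ] ∑[ j < n ] (χ (P i) * χ (Q j ∧ adj G i j))  ≡⟨ sum-cong-≗ (λ i → sum-cong-≗ (term≡0 i)) ⟩
      ∑[ i < n ] ∑[ j < n ] 0                                ≡⟨ sum-cong-≗ {n} (λ _ → sum-replicate-zero n) ⟩
      ∑[ i < n ] 0                                           ≡⟨ sum-replicate-zero n ⟩
      0                                                      ∎
      where
      open ≡-Reasoning
      term≡0 : ∀ i j → χ (P i) * χ (Q j ∧ adj G i j) ≡ 0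
      term≡0 i j with P i in pᵢ | Q j in qⱼ | adj G i j in aᵢⱼ
      ... | true  | true  | true  = contradiction aᵢⱼ (no-edge i j pᵢ qⱼ)
      ... | true  | true  | false = refl
      ... | true  | false | _     = refl
      ... | false | _     | _     = refl

    forward : Fin n → Fin n → ℕ
    forward i j = if toℕ i <ᵇ toℕ j then χ (adj G i j) else 0

    e≡∑∑forward : e G ≡ ∑[ i < n ] ∑[ j < n ] forward i j
    e≡∑∑forward = trans (sum-map-allFin (λ i → sum (map (forward i) (allFin n))))
                        (sum-cong-≗ (λ i → sum-map-allFin (forward i)))

    forward+backward : ∀ i j → forward i j + forward j i ≡ χ (adj G i j)
    forward+backward i j with toℕ i <ᵇ toℕ j | <ᵇ-reflects-< (toℕ i) (toℕ j)
                            | toℕ j <ᵇ toℕ i | <ᵇ-reflects-< (toℕ j) (toℕ i)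
    ... | true  | ofʸ i<j | true  | ofʸ j<i = contradiction j<i (<-asym i<j)
    ... | true  | _       | false | _       = +-identityʳ (χ (adj G i j))
    ... | false | _       | true  | _       = cong χ (symm G j i)
    ... | false | ofⁿ i≮j | false | ofⁿ j≮i
      with Fin.toℕ-injective (≤-antisym (≮⇒≥ j≮i) (≮⇒≥ i≮j))
    ...   | refl = cong χ (sym (irrefl G i))

    handshake : 2 * e G ≡ arcs ⊤ ⊤
    handshake = begin
      2 * e G
        ≡⟨ cong (2 *_) e≡∑∑forward ⟩
      2 * E
        ≡⟨ cong (E +_) (+-identityʳ E) ⟩
      E + E
        ≡⟨ cong (E +_) (∑-comm forward) ⟩
      E + ∑[ i < n ] ∑[ j < n ] forward j i
        ≡⟨ ∑-distrib-+ (λ i → ∑[ j < n ] forward i j) (λ i → ∑[ j < n ] forward j i) ⟨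
      ∑[ i < n ] (∑[ j < n ] forward i j + ∑[ j < n ] forward j i)
        ≡⟨ sum-cong-≗ (λ i → ∑-distrib-+ (forward i) (λ j → forward j i)) ⟨
      ∑[ i < n ] ∑[ j < n ] (forward i j + forward j i)
        ≡⟨ sum-cong-≗ (λ i → sum-cong-≗ (forward+backward i)) ⟩
      ∑[ i < n ] deg ⊤ i
        ≡⟨ sum-cong-≗ (λ i → *-identityˡ (deg ⊤ i)) ⟨
      arcs ⊤ ⊤
        ∎
      where
      open ≡-Reasoning
      E = ∑[ i < n ] ∑[ j < n ] forward i j

card⊤≡n : ∀ {n} → card (⊤ {n}) ≡ n
card⊤≡n {zero}  = refl
card⊤≡n {suc n} = cong suc (card⊤≡n {n})

∣p∣≡card : ∀ {n} (p : Subset n) → ∣ p ∣ ≡ card (lookup p)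
∣p∣≡card []          = refl
∣p∣≡card (true ∷ p)  = cong suc (∣p∣≡card p)
∣p∣≡card (false ∷ p) = ∣p∣≡card p

argmax-within : ∀ {n} (P : Fin n → Bool) (f : Fin n → ℕ) →
  (∀ u → P u ≡ false) ⊎ ∃ λ v → P v ≡ true × (∀ u → P u ≡ true → f u ≤ f v)
argmax-within {zero}  P f = inj₁ λ ()
argmax-within {suc n} P f with argmax-within (λ u → P (suc u)) (λ u → f (suc u)) | P zero in p₀
... | inj₁ none | false = inj₁ λ { zero → p₀ ; (suc u) → none u }
... | inj₁ none | true  = inj₂ (zero , p₀ , λ
  { zero    _  → ≤-refl
  ; (suc u) pᵤ → contradiction (none u) (not-¬ pᵤ) })
... | inj₂ (v , pᵥ , fᵤ≤fᵥ) | false = inj₂ (suc v , pᵥ , λ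
  { zero    pᵤ → contradiction p₀ (not-¬ pᵤ)
  ; (suc u) pᵤ → fᵤ≤fᵥ u pᵤ })
... | inj₂ (v , pᵥ , fᵤ≤fᵥ) | true with f zero ≤? f (suc v)
...   | yes f₀≤fᵥ = inj₂ (suc v , pᵥ , λ
  { zero    _  → f₀≤fᵥ
  ; (suc u) pᵤ → fᵤ≤fᵥ u pᵤ })
...   | no  f₀≰fᵥ = inj₂ (zero , p₀ , λ
  { zero    _  → ≤-refl
  ; (suc u) pᵤ → ≤-trans (fᵤ≤fᵥ u pᵤ) (<⇒≤ (≰⇒> f₀≰fᵥ)) })

4xy≤[x+y]² : ∀ x y → 4 * (x * y) ≤ (x + y) * (x + y)
4xy≤[x+y]² x y = [ ordered , swapped ]′ (≤-total x y)
  where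
  ordered : ∀ {x y} → x ≤ y → 4 * (x * y) ≤ (x + y) * (x + y)
  ordered {x} x≤y with m≤n⇒∃[o]m+o≡n x≤y
  ... | d , refl = subst (4 * (x * (x + d)) ≤_) (square x d) (m≤m+n _ (d * d))
    where
    square : ∀ x d → 4 * (x * (x + d)) + d * d ≡ (x + (x + d)) * (x + (x + d))
    square = solve-∀
  swapped : y ≤ x → 4 * (x * y) ≤ (x + y) * (x + y)
  swapped y≤x = subst₂ (λ a b → 4 * a ≤ b * b) (*-comm y x) (+-comm y x) (ordered y≤x)

module _ {n : ℕ} (G : Graph n) where

  neighbourhood : Fin n → Subset n
  neighbourhood v = Vec.tabulate (adj G v)

  ∈-neighbourhood⇒Adj : ∀ {v u} → u ∈ neighbourhood v → Adj G v u
  ∈-neighbourhood⇒Adj {v} {u} u∈N = trans (sym (lookup∘tabulate (adj G v) u)) ([]=⇒lookup u∈N)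

  K4-free⇒neighbourhood-triangle-free : K4-free G → ∀ v → TriangleFreeIn G (neighbourhood v)
  K4-free⇒neighbourhood-triangle-free k4 v a b c a∈N b∈N c∈N (ab , ac , bc) =
    k4 v a b c (∈-neighbourhood⇒Adj a∈N , ∈-neighbourhood⇒Adj b∈N , ∈-neighbourhood⇒Adj c∈N
               , ab , ac , bc)

  ∣neighbourhood∣≡deg : ∀ v → ∣ neighbourhood v ∣ ≡ deg G ⊤ v
  ∣neighbourhood∣≡deg v = trans (∣p∣≡card (neighbourhood v))
    (sum-cong-≗ (λ u → cong χ (lookup∘tabulate (adj G v) u)))

  deg≤maxTriangleFree : K4-free G → ∀ {Z} → MaxTriangleFree G Z → ∀ v → deg G ⊤ v ≤ ∣ Z ∣
  deg≤maxTriangleFree k4 (_ , maximal) v = subst (_≤ _) (∣neighbourhood∣≡deg v)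
    (maximal (neighbourhood v) (K4-free⇒neighbourhood-triangle-free k4 v))

  -- The neighbours of v in Z are pairwise non-adjacent, so every arc inside Z
  -- has an end in Z ∖ N(v), where degrees are at most Δ = deg v = |Z ∩ N(v)|.
  mantel-at-max-degree : ∀ Z → TriangleFreeIn G Z → ∀ v → lookup Z v ≡ true →
    (∀ u → lookup Z u ≡ true → deg G (lookup Z) u ≤ deg G (lookup Z) v) →
    2 * arcs G (lookup Z) (lookup Z) ≤ card (lookup Z) * card (lookup Z)
  mantel-at-max-degree Z triangle-free v zᵥ v-maximal = begin
    2 * arcs G P P                ≤⟨ *-monoʳ-≤ 2 arcs≤2*outside ⟩
    2 * (2 * arcs G (P ∖ N) P)    ≡⟨ *-assoc 2 2 (arcs G (P ∖ N) P) ⟨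
    4 * arcs G (P ∖ N) P          ≤⟨ *-monoʳ-≤ 4 (arcs≤card*maxdeg G (P ∖ N) P Δ outside-deg≤Δ) ⟩
    4 * (k * Δ)                   ≡⟨ cong (4 *_) (*-comm k Δ) ⟩
    4 * (Δ * k)                   ≤⟨ 4xy≤[x+y]² Δ k ⟩
    (Δ + k) * (Δ + k)             ≡⟨ cong₂ _*_ (card-split P N) (card-split P N) ⟨
    card P * card P               ∎
    where
    open ≤-Reasoning
    P = lookup Z
    N = adj G v
    Δ = deg G P v
    k = card (P ∖ N)
    ∈Z : ∀ {i} → P i ≡ true → i ∈ Z
    ∈Z {i} = lookup⇒[]= i Z
    P∩N-independent : ∀ i j → (P ∩ N) i ≡ true → (P ∩ N) j ≡ true → ¬ Adj G i j
    P∩N-independent i j pnᵢ pnⱼ aᵢⱼ = triangle-free v i j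
      (∈Z zᵥ) (∈Z (∧-conicalˡ _ _ pnᵢ)) (∈Z (∧-conicalˡ _ _ pnⱼ))
      (∧-conicalʳ _ _ pnᵢ , ∧-conicalʳ _ _ pnⱼ , aᵢⱼ)
    outside-deg≤Δ : ∀ u → (P ∖ N) u ≡ true → deg G P u ≤ Δ
    outside-deg≤Δ u pᵤ = v-maximal u (∧-conicalˡ _ _ pᵤ)
    arcs≤2*outside : arcs G P P ≤ 2 * arcs G (P ∖ N) P
    arcs≤2*outside = subst (λ a → arcs G P P ≤ a + 2 * arcs G (P ∖ N) P)
      (arcs≡0 G (P ∩ N) (P ∩ N) P∩N-independent) (arcs≤inside+2*outside G P N)

  mantel : ∀ Z → TriangleFreeIn G Z →
    2 * arcs G (lookup Z) (lookup Z) ≤ card (lookup Z) * card (lookup Z)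
  mantel Z triangle-free with argmax-within (lookup Z) (deg G (lookup Z))
  ... | inj₁ empty = subst (λ a → 2 * a ≤ _) (sym (arcs≡0 G (lookup Z) (lookup Z) no-arcs)) z≤n
    where
    no-arcs : ∀ i j → lookup Z i ≡ true → lookup Z j ≡ true → ¬ Adj G i j
    no-arcs i _ zᵢ _ _ = contradiction (empty i) (not-¬ zᵢ)
  ... | inj₂ (v , zᵥ , v-maximal) = mantel-at-max-degree Z triangle-free v zᵥ v-maximal

2e≤a+2b⇒4e+3z²≤4z[z+y] : ∀ e a b y z → 2 * e ≤ a + 2 * b → 2 * a ≤ z * z → b ≤ y * z →
  4 * e + 3 * (z * z) ≤ 4 * (z * (z + y))
2e≤a+2b⇒4e+3z²≤4z[z+y] e a b y z 2e≤ 2a≤ b≤ = begin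
  4 * e + 3 * (z * z)               ≡⟨ cong (_+ 3 * (z * z)) (*-assoc 2 2 e) ⟩
  2 * (2 * e) + 3 * (z * z)         ≤⟨ +-monoˡ-≤ (3 * (z * z)) (*-monoʳ-≤ 2 2e≤) ⟩
  2 * (a + 2 * b) + 3 * (z * z)     ≡⟨ expand a b z ⟩
  2 * a + 4 * b + 3 * (z * z)       ≤⟨ +-monoˡ-≤ (3 * (z * z)) (+-mono-≤ 2a≤ (*-monoʳ-≤ 4 b≤)) ⟩
  z * z + 4 * (y * z) + 3 * (z * z) ≡⟨ collect y z ⟩
  4 * (z * (z + y))                 ∎
  where
  open ≤-Reasoning
  expand : ∀ a b z → 2 * (a + 2 * b) + 3 * (z * z) ≡ 2 * a + 4 * b + 3 * (z * z)
  expand = solve-∀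
  collect : ∀ y z → z * z + 4 * (y * z) + 3 * (z * z) ≡ 4 * (z * (z + y))
  collect = solve-∀

maxTriangleFree-bounds : ∀ {n} (G : Graph n) → K4-free G → ∀ Z → MaxTriangleFree G Z →
  (2 * e G ≤ ∣ Z ∣ * n) × (4 * e G + 3 * (∣ Z ∣ * ∣ Z ∣) ≤ 4 * (∣ Z ∣ * n))
maxTriangleFree-bounds {n} G k4 Z (triangle-free , maximal) = 2e≤zn , 4e+3z²≤4zn
  where
  open ≤-Reasoning
  V P : Fin n → Bool
  V = ⊤
  P = lookup Z
  z = ∣ Z ∣
  arcs-from≤ : ∀ Q → arcs G Q V ≤ card Q * z
  arcs-from≤ Q = arcs≤card*maxdeg G Q V z λ v _ → deg≤maxTriangleFree G k4 (triangle-free , maximal) v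
  2e≤zn : 2 * e G ≤ z * n
  2e≤zn = begin
    2 * e G       ≡⟨ handshake G ⟩
    arcs G V V    ≤⟨ arcs-from≤ V ⟩
    card V * z    ≡⟨ cong (_* z) (card⊤≡n {n}) ⟩
    n * z         ≡⟨ *-comm n z ⟩
    z * n         ∎
  n≡z+y : n ≡ z + card (V ∖ P)
  n≡z+y = begin-equality
    n                          ≡⟨ card⊤≡n {n} ⟨
    card V                     ≡⟨ card-split V P ⟩
    card P + card (V ∖ P)      ≡⟨ cong (_+ card (V ∖ P)) (∣p∣≡card Z) ⟨
    z + card (V ∖ P)           ∎
  4e+3z²≤4zn : 4 * e G + 3 * (z * z) ≤ 4 * (z * n)
  4e+3z²≤4zn = subst (λ m → 4 * e G + 3 * (z * z) ≤ 4 * (z * m)) (sym n≡z+y)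
    (2e≤a+2b⇒4e+3z²≤4z[z+y] (e G) (arcs G P P) (arcs G (V ∖ P) V) (card (V ∖ P)) z
      -- V ∩ P computes to P
      (≤-trans (≤-reflexive (handshake G)) (arcs≤inside+2*outside G V P))
      (subst (λ c → 2 * arcs G P P ≤ c * c) (sym (∣p∣≡card Z)) (mantel G Z triangle-free))
      (arcs-from≤ (V ∖ P)))

triangleFreeIn? : ∀ {n} (G : Graph n) → Decidable (TriangleFreeIn G)
triangleFreeIn? G S = Fin.all? λ a → Fin.all? λ b → Fin.all? λ c →
  a ∈? S →-dec b ∈? S →-dec c ∈? S →-dec ¬? (adj? a b ×-dec adj? a c ×-dec adj? b c)
  where
  adj? : ∀ i j → Dec (Adj G i j)
  adj? i j = adj G i j Bool.≟ true

maximum-exists : ∀ {n ℓ} {P : Pred (Subset n) ℓ} → Decidable P → ∀ {T₀} → P T₀ →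
  ∃ λ Z → P Z × (∀ T → P T → ∣ T ∣ ≤ ∣ Z ∣)
maximum-exists {n} {P = P} P? {T₀} p₀ = search n (λ T _ → ∣p∣≤n T)
  where
  search : ∀ m → (∀ T → P T → ∣ T ∣ ≤ m) → ∃ λ Z → P Z × (∀ T → P T → ∣ T ∣ ≤ ∣ Z ∣)
  search m ≤m with anySubset? (λ T → P? T ×-dec m ≤? ∣ T ∣)
  ... | yes (Z , pZ , m≤∣Z∣) = Z , pZ , λ T pT → ≤-trans (≤m T pT) m≤∣Z∣
  search zero    ≤m | no none = contradiction (T₀ , p₀ , z≤n) none
  search (suc m) ≤m | no none = search m λ T pT → ≤-pred (≰⇒> λ m<∣T∣ → none (T , pT , m<∣T∣))

-- Raising z₀ by d changes 4zn − 3z² by d(4n − 6z₀ − 3d), which is ≤ 0 once 2n ≤ 3z₀.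
4e+3z²≤4zn-antitone : ∀ {e z₀ z n} → z₀ ≤ z → 2 * n ≤ 3 * z₀ →
  4 * e + 3 * (z * z) ≤ 4 * (z * n) → 4 * e + 3 * (z₀ * z₀) ≤ 4 * (z₀ * n)
4e+3z²≤4zn-antitone {e} {z₀} {_} {n} z₀≤z 2n≤3z₀ bound with m≤n⇒∃[o]m+o≡n z₀≤z
... | d , refl = +-cancelʳ-≤ extra (4 * e + 3 * (z₀ * z₀)) (4 * (z₀ * n)) (begin
  4 * e + 3 * (z₀ * z₀) + extra       ≡⟨ expand-left e z₀ d ⟩
  4 * e + 3 * ((z₀ + d) * (z₀ + d))   ≤⟨ bound ⟩
  4 * ((z₀ + d) * n)                  ≡⟨ expand-right z₀ d n ⟩
  4 * (z₀ * n) + (2 * d) * (2 * n)    ≤⟨ +-monoʳ-≤ (4 * (z₀ * n)) (*-monoʳ-≤ (2 * d) 2n≤3z₀) ⟩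
  4 * (z₀ * n) + (2 * d) * (3 * z₀)   ≡⟨ cong (4 * (z₀ * n) +_) (reorder z₀ d) ⟩
  4 * (z₀ * n) + 6 * (z₀ * d)         ≤⟨ +-monoʳ-≤ (4 * (z₀ * n)) (m≤m+n (6 * (z₀ * d)) (3 * (d * d))) ⟩
  4 * (z₀ * n) + extra                ∎)
  where
  open ≤-Reasoning
  extra = 6 * (z₀ * d) + 3 * (d * d)
  expand-left : ∀ e z₀ d →
    4 * e + 3 * (z₀ * z₀) + (6 * (z₀ * d) + 3 * (d * d)) ≡ 4 * e + 3 * ((z₀ + d) * (z₀ + d))
  expand-left = solve-∀
  expand-right : ∀ z₀ d n → 4 * ((z₀ + d) * n) ≡ 4 * (z₀ * n) + (2 * d) * (2 * n)
  expand-right = solve-∀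
  reorder : ∀ z₀ d → (2 * d) * (3 * z₀) ≡ 6 * (z₀ * d)
  reorder = solve-∀

largeTriangleFree-bound : ∀ {n} (G : Graph n) → K4-free G →
  ∀ Z₀ → TriangleFreeIn G Z₀ → 2 * n ≤ 3 * ∣ Z₀ ∣ → 4 * e G + 3 * (∣ Z₀ ∣ * ∣ Z₀ ∣) ≤ 4 * (∣ Z₀ ∣ * n)
largeTriangleFree-bound G k4 Z₀ Z₀-triangle-free 2n≤3z₀
  with maximum-exists (triangleFreeIn? G) Z₀-triangle-free
... | Z , Z-triangle-free , maximal =
  4e+3z²≤4zn-antitone {e = e G} (maximal Z₀ Z₀-triangle-free) 2n≤3z₀
    (proj₂ (maxTriangleFree-bounds G k4 Z (Z-triangle-free , maximal)))

lemma3p1 : ∀ (n : ℕ) (G : Graph n) → K4-free G →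
    (∀ (Z : Subset n) → MaxTriangleFree G Z →
       (2 * e G ≤ ∣ Z ∣ * n) × (4 * e G + 3 * (∣ Z ∣ * ∣ Z ∣) ≤ 4 * (∣ Z ∣ * n)))
    × (∀ (Z₀ : Subset n) → TriangleFreeIn G Z₀ → 2 * n ≤ 3 * ∣ Z₀ ∣ →
       4 * e G + 3 * (∣ Z₀ ∣ * ∣ Z₀ ∣) ≤ 4 * (∣ Z₀ ∣ * n))
lemma3p1 n G k4 = maxTriangleFree-bounds G k4 , largeTriangleFree-bound G k4
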